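{- For all integers $r, s \ge 1$, $\mathcal{P}_r \cap \mathcal{P}_s = \mathcal{P}_{\operatorname{lcm}(r,s)}$.
   Context: $R := 1 + x\mathbb{Z}[[x]]$ is the set of formal power series with integer coefficients and constant term $1$, and for an integer $n \ge 1$, $\mathcal{P}_n := \{ g^n \mid g \in R\}$. -}

module Defs where

open import Data.Nat using (ℕ; zero; suc; _∸_)
open import Data.Integer using (ℤ; _+_; _*_; 0ℤ; 1ℤ)
open import Data.Product using (Σ; _×_)
open import Relation.Binary.PropositionalEquality using (_≡_)

PowerSeries : Set
PowerSeries = ℕ → ℤ

_≈ₚ_ : PowerSeries → PowerSeries → Set
f ≈ₚ g = ∀ n → f n ≡ g n

sumTo : ℕ → (ℕ → ℤ) → ℤ
sumTo zero    f = f zero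
sumTo (suc n) f = sumTo n f + f (suc n)

_⊛_ : PowerSeries → PowerSeries → PowerSeries
(f ⊛ g) n = sumTo n (λ i → f i * g (n ∸ i))

oneₚ : PowerSeries
oneₚ zero    = 1ℤ
oneₚ (suc _) = 0ℤ

_^ₚ_ : PowerSeries → ℕ → PowerSeries
g ^ₚ zero  = oneₚ
g ^ₚ suc n = g ⊛ (g ^ₚ n)

InR : PowerSeries → Set
InR f = f zero ≡ 1ℤ

Pow : ℕ → PowerSeries → Set
Pow n f = Σ PowerSeries (λ g → InR g × (g ^ₚ n) ≈ₚ f)

{-# OPTIONS --safe #-}
module Submission where

open import Defs
open import Data.Nat using (ℕ; _≥_)
open import Data.Nat.LCM using (lcm)
open import Data.Product using (_×_)
open import Function.Bundles using (_⇔_)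

-- The series with constant term 1 form an abelian group under multiplication: the
-- coefficients of the inverse are determined one degree at a time.  In any abelian group,
-- if f = aʳ = bˢ, write lcm(r, s) = L = rα = sβ; then α and β are coprime, so Bézout gives
-- xα = 1 + yβ (up to swapping roles), and aˣ b⁻ʸ is an L-th root of f.  Conversely an L-th
-- power is an r-th and an s-th power since r and s divide L.

open import Level using (0ℓ; _⊔_)
open import Algebra.Bundles using (AbelianGroup)
open import Algebra.Core using (Op₁; Op₂)
open import Data.Nat as ℕ using (zero; suc; _∸_; _≤_; _≤′_; ≤′-refl; ≤′-step; NonZero)
import Data.Nat.Properties as ℕₚ
open import Algebra.Properties.CommutativeSemigroup ℕₚ.*-commutativeSemigroup using (x∙yz≈y∙xz)
import Data.Nat.Coprimality as Coprime
open Coprime using (Coprime; coprime-/gcd; coprime-Bézout)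
open import Data.Nat.Divisibility using (_∣_; divides)
open import Data.Nat.DivMod using (_/_; *-/-assoc)
open import Data.Nat.GCD using (gcd; gcd[m,n]∣m; gcd[m,n]∣n; gcd[m,n]≢0; module Bézout)
open import Data.Nat.LCM using (m∣lcm[m,n]; n∣lcm[m,n])
open import Data.Product using (Σ; ∃; ∃₂; _,_; proj₁; proj₂)
open import Data.Product.Function.NonDependent.Propositional using (_×-⇔_)
open import Data.Sum using (inj₁)
open import Function using (_on_)
open import Function.Bundles using (mk⇔; Equivalence)
open import Function.Properties.Equivalence using (⇔-setoid)
open import Relation.Binary.Bundles using (Setoid)
import Relation.Binary.Construct.On as On
open import Relation.Binary.PropositionalEquality
  using (_≡_; refl; sym; trans; cong; cong₂; subst; _→-setoid_; module ≡-Reasoning)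
import Relation.Binary.Reasoning.Setoid as SetoidReasoning

lcm-cofactors : ∀ r s .{{_ : NonZero r}} →
                ∃₂ λ α β → Coprime α β × r ℕ.* α ≡ lcm r s × s ℕ.* β ≡ lcm r s
-- For r ≠ 0, lcm r s is by definition r * (s / gcd r s).
lcm-cofactors r@(suc _) s = s / d , r / d , Coprime.sym (coprime-/gcd r s) , refl , s[r/d]≡lcm
  where
  d = gcd r s
  instance d≢0 : NonZero d
  d≢0 = ℕ.≢-nonZero (gcd[m,n]≢0 r s (inj₁ λ ()))
  s[r/d]≡lcm : s ℕ.* (r / d) ≡ r ℕ.* (s / d)
  s[r/d]≡lcm = begin
    s ℕ.* (r / d)   ≡⟨ *-/-assoc s (gcd[m,n]∣m r s) ⟨
    s ℕ.* r / d     ≡⟨ cong (_/ d) (ℕₚ.*-comm s r) ⟩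
    r ℕ.* s / d     ≡⟨ *-/-assoc r (gcd[m,n]∣n r s) ⟩
    r ℕ.* (s / d)   ∎
    where open ≡-Reasoning

module AbelianGroupPowers {c ℓ} (G : AbelianGroup c ℓ) where

  open AbelianGroup G renaming (refl to ≈-refl; sym to ≈-sym; trans to ≈-trans)
  open import Data.Nat using (_+_; _*_)
  open import Algebra.Properties.Monoid.Mult monoid using (×-congˡ; ×-congʳ; ×-assocˡ)
    renaming (_×_ to _×ₙ_)
  open import Algebra.Properties.CommutativeMonoid.Mult commutativeMonoid using (×-distrib-+)
  open SetoidReasoning setoid

  infixr 7.5 _^_
  _^_ : Carrier → ℕ → Carrier
  x ^ n = n ×ₙ x

  IsPower : ℕ → Carrier → Set (c ⊔ ℓ)
  IsPower n x = ∃ λ g → g ^ n ≈ x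

  ^-* : ∀ x m n → (x ^ m) ^ n ≈ x ^ (m * n)
  ^-* x m n = ≈-trans (×-assocˡ x n m) (×-congˡ (ℕₚ.*-comm n m))

  ε^n≈ε : ∀ n → ε ^ n ≈ ε
  ε^n≈ε zero    = ≈-refl
  ε^n≈ε (suc n) = ≈-trans (identityˡ (ε ^ n)) (ε^n≈ε n)

  ^-inverseʳ : ∀ x n → x ^ n ∙ x ⁻¹ ^ n ≈ ε
  ^-inverseʳ x n =
    ≈-trans (≈-sym (×-distrib-+ x (x ⁻¹) n)) (≈-trans (×-congʳ n (inverseʳ x)) (ε^n≈ε n))

  -- If f = aʳ = bˢ then (aˣ b⁻ʸ)ᴸ = f^(xα) f^(-yβ) = f.
  IsPower-bézout : ∀ {f L} r s α β x y → r * α ≡ L → s * β ≡ L → 1 + y * β ≡ x * α →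
                   IsPower r f → IsPower s f → IsPower L f
  IsPower-bézout {f} {L} r s α β x y rα≡L sβ≡L 1+yβ≡xα (a , a^r≈f) (b , b^s≈f) =
    a ^ x ∙ b ⁻¹ ^ y , (begin
      (a ^ x ∙ b ⁻¹ ^ y) ^ L               ≈⟨ ×-distrib-+ (a ^ x) (b ⁻¹ ^ y) L ⟩
      (a ^ x) ^ L ∙ (b ⁻¹ ^ y) ^ L         ≈⟨ ∙-cong a^x^L (^-* (b ⁻¹) y L) ⟩
      f ∙ b ^ (y * L) ∙ b ⁻¹ ^ (y * L)     ≈⟨ assoc f _ _ ⟩
      f ∙ (b ^ (y * L) ∙ b ⁻¹ ^ (y * L))   ≈⟨ ∙-congˡ (^-inverseʳ b (y * L)) ⟩
      f ∙ ε                                ≈⟨ identityʳ f ⟩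
      f                                    ∎)
    where
    a^x^L : (a ^ x) ^ L ≈ f ∙ b ^ (y * L)
    a^x^L = begin
      (a ^ x) ^ L            ≈⟨ ^-* a x L ⟩
      a ^ (x * L)            ≡⟨ cong (λ e → a ^ (x * e)) rα≡L ⟨
      a ^ (x * (r * α))      ≡⟨ cong (a ^_) (x∙yz≈y∙xz x r α) ⟩
      a ^ (r * (x * α))      ≈⟨ ^-* a r (x * α) ⟨
      (a ^ r) ^ (x * α)      ≈⟨ ×-congʳ (x * α) a^r≈f ⟩
      f ^ (x * α)            ≡⟨ cong (f ^_) 1+yβ≡xα ⟨
      f ∙ f ^ (y * β)        ≈⟨ ∙-congˡ (×-congʳ (y * β) b^s≈f) ⟨
      f ∙ (b ^ s) ^ (y * β)  ≈⟨ ∙-congˡ (^-* b s (y * β)) ⟩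
      f ∙ b ^ (s * (y * β))  ≡⟨ cong (λ e → f ∙ b ^ e) (x∙yz≈y∙xz s y β) ⟩
      f ∙ b ^ (y * (s * β))  ≡⟨ cong (λ e → f ∙ b ^ (y * e)) sβ≡L ⟩
      f ∙ b ^ (y * L)        ∎

  IsPower-∣ : ∀ {m n x} → m ∣ n → IsPower n x → IsPower m x
  IsPower-∣ {m} (divides k n≡k*m) (g , g^n≈x) =
    g ^ k , ≈-trans (^-* g k m) (≈-trans (reflexive (cong (g ^_) (sym n≡k*m))) g^n≈x)

  IsPower-lcm : ∀ r s {x} → (IsPower r x × IsPower s x) ⇔ IsPower (lcm r s) x
  IsPower-lcm r s = mk⇔ (common-root r s)
    λ p → IsPower-∣ (m∣lcm[m,n] r s) p , IsPower-∣ (n∣lcm[m,n] r s) p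
    where
    common-root : ∀ r s {x} → IsPower r x × IsPower s x → IsPower (lcm r s) x
    common-root zero      s (p , _) = p
    common-root r@(suc _) s (p , q)
      with α , β , α⊥β , rα≡L , sβ≡L ← lcm-cofactors r s
      with coprime-Bézout α⊥β
    ... | Bézout.+- i j 1+jβ≡iα = IsPower-bézout r s α β i j rα≡L sβ≡L 1+jβ≡iα p q
    ... | Bézout.-+ i j 1+iα≡jβ = IsPower-bézout s r β α j i sβ≡L rα≡L 1+iα≡jβ q p

open import Data.Integer using (ℤ; _+_; _*_; -_; 0ℤ; 1ℤ)
open import Data.Integer.Properties
  using (+-comm; +-assoc; +-identityʳ; *-comm; *-assoc; *-identityˡ; *-zeroˡ; *-distribˡ-+; *-distribʳ-+)
open import Data.Integer.Tactic.RingSolver using (solve-∀)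

sumTo-cong : ∀ n {F G : ℕ → ℤ} → (∀ i → i ≤ n → F i ≡ G i) → sumTo n F ≡ sumTo n G
sumTo-cong zero    F≡G = F≡G 0 ℕ.z≤n
sumTo-cong (suc n) F≡G =
  cong₂ _+_ (sumTo-cong n (λ i i≤n → F≡G i (ℕₚ.m≤n⇒m≤1+n i≤n))) (F≡G (suc n) ℕₚ.≤-refl)

sumTo-distrib-+ : ∀ n F G → sumTo n (λ i → F i + G i) ≡ sumTo n F + sumTo n G
sumTo-distrib-+ zero    F G = refl
sumTo-distrib-+ (suc n) F G rewrite sumTo-distrib-+ n F G =
  interchange (sumTo n F) (sumTo n G) (F (suc n)) (G (suc n))
  where
  interchange : ∀ a b c d → a + b + (c + d) ≡ a + c + (b + d)
  interchange = solve-∀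

*-distribˡ-sumTo : ∀ c n F → c * sumTo n F ≡ sumTo n (λ i → c * F i)
*-distribˡ-sumTo c zero    F = refl
*-distribˡ-sumTo c (suc n) F rewrite sym (*-distribˡ-sumTo c n F) = *-distribˡ-+ c (sumTo n F) (F (suc n))

sumTo-sucˡ : ∀ n F → sumTo (suc n) F ≡ F 0 + sumTo n (λ i → F (suc i))
sumTo-sucˡ zero    F = refl
sumTo-sucˡ (suc n) F = trans (cong (_+ F (suc (suc n))) (sumTo-sucˡ n F)) (+-assoc (F 0) _ _)

sumTo-reverse : ∀ n F → sumTo n F ≡ sumTo n (λ i → F (n ∸ i))
sumTo-reverse zero    F = refl
sumTo-reverse (suc n) F = begin
  sumTo n F + F (suc n)                  ≡⟨ cong (_+ F (suc n)) (sumTo-reverse n F) ⟩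
  sumTo n (λ i → F (n ∸ i)) + F (suc n)  ≡⟨ +-comm _ (F (suc n)) ⟩
  F (suc n) + sumTo n (λ i → F (n ∸ i))  ≡⟨ sumTo-sucˡ n (λ i → F (suc n ∸ i)) ⟨
  sumTo (suc n) (λ i → F (suc n ∸ i))    ∎
  where open ≡-Reasoning

shift : PowerSeries → PowerSeries
shift f i = f (suc i)

⊛-suc : ∀ f g n → (f ⊛ g) (suc n) ≡ f 0 * g (suc n) + (shift f ⊛ g) n
⊛-suc f g n = sumTo-sucˡ n (λ i → f i * g (suc n ∸ i))

⊛-congʳ-≤ : ∀ f {g g′} n → (∀ i → i ≤ n → g i ≡ g′ i) → (f ⊛ g) n ≡ (f ⊛ g′) n
⊛-congʳ-≤ f n g≡g′ = sumTo-cong n (λ i _ → cong (f i *_) (g≡g′ (n ∸ i) (ℕₚ.m∸n≤m n i)))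

⊛-cong : ∀ {f f′ g g′} → f ≈ₚ f′ → g ≈ₚ g′ → (f ⊛ g) ≈ₚ (f′ ⊛ g′)
⊛-cong f≈f′ g≈g′ n = sumTo-cong n (λ i _ → cong₂ _*_ (f≈f′ i) (g≈g′ (n ∸ i)))

⊛-comm : ∀ f g → (f ⊛ g) ≈ₚ (g ⊛ f)
⊛-comm f g n = trans (sumTo-reverse n _) (sumTo-cong n swap)
  where
  swap : ∀ i → i ≤ n → f (n ∸ i) * g (n ∸ (n ∸ i)) ≡ g i * f (n ∸ i)
  swap i i≤n rewrite ℕₚ.m∸[m∸n]≡n i≤n = *-comm (f (n ∸ i)) (g i)

⊛-linearˡ : ∀ c u v h n → ((λ i → c * u i + v i) ⊛ h) n ≡ c * (u ⊛ h) n + (v ⊛ h) n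
⊛-linearˡ c u v h n = begin
  sumTo n (λ i → (c * u i + v i) * h (n ∸ i))
    ≡⟨ sumTo-cong n (λ i _ → trans (*-distribʳ-+ (h (n ∸ i)) (c * u i) (v i))
                                   (cong (_+ v i * h (n ∸ i)) (*-assoc c (u i) (h (n ∸ i))))) ⟩
  sumTo n (λ i → c * (u i * h (n ∸ i)) + v i * h (n ∸ i))
    ≡⟨ sumTo-distrib-+ n _ _ ⟩
  sumTo n (λ i → c * (u i * h (n ∸ i))) + (v ⊛ h) n
    ≡⟨ cong (_+ (v ⊛ h) n) (*-distribˡ-sumTo c n _) ⟨
  c * (u ⊛ h) n + (v ⊛ h) n ∎
  where open ≡-Reasoning

⊛-assoc : ∀ f g h → ((f ⊛ g) ⊛ h) ≈ₚ (f ⊛ (g ⊛ h))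
⊛-assoc f g h zero    = *-assoc (f 0) (g 0) (h 0)
⊛-assoc f g h (suc n) = begin
  ((f ⊛ g) ⊛ h) (suc n)
    ≡⟨ ⊛-suc (f ⊛ g) h n ⟩
  f 0 * g 0 * h (suc n) + (shift (f ⊛ g) ⊛ h) n
    ≡⟨ cong (f 0 * g 0 * h (suc n) +_) (⊛-cong {g = h} (λ i → ⊛-suc f g i) (λ _ → refl) n) ⟩
  f 0 * g 0 * h (suc n) + ((λ i → f 0 * shift g i + (shift f ⊛ g) i) ⊛ h) n
    ≡⟨ cong (f 0 * g 0 * h (suc n) +_) (⊛-linearˡ (f 0) (shift g) (shift f ⊛ g) h n) ⟩
  f 0 * g 0 * h (suc n) + (f 0 * (shift g ⊛ h) n + ((shift f ⊛ g) ⊛ h) n)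
    ≡⟨ cong (λ t → f 0 * g 0 * h (suc n) + (f 0 * (shift g ⊛ h) n + t)) (⊛-assoc (shift f) g h n) ⟩
  f 0 * g 0 * h (suc n) + (f 0 * (shift g ⊛ h) n + (shift f ⊛ (g ⊛ h)) n)
    ≡⟨ factor (f 0) (g 0) (h (suc n)) ((shift g ⊛ h) n) ((shift f ⊛ (g ⊛ h)) n) ⟩
  f 0 * (g 0 * h (suc n) + (shift g ⊛ h) n) + (shift f ⊛ (g ⊛ h)) n
    ≡⟨ cong (λ t → f 0 * t + (shift f ⊛ (g ⊛ h)) n) (⊛-suc g h n) ⟨
  f 0 * (g ⊛ h) (suc n) + (shift f ⊛ (g ⊛ h)) n
    ≡⟨ ⊛-suc f (g ⊛ h) n ⟨
  (f ⊛ (g ⊛ h)) (suc n) ∎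
  where
  open ≡-Reasoning
  factor : ∀ a b c d e → a * b * c + (a * d + e) ≡ a * (b * c + d) + e
  factor = solve-∀

⊛-identityˡ : ∀ f → (oneₚ ⊛ f) ≈ₚ f
⊛-identityˡ f zero    = *-identityˡ (f 0)
⊛-identityˡ f (suc n) = begin
  (oneₚ ⊛ f) (suc n)                   ≡⟨ ⊛-suc oneₚ f n ⟩
  1ℤ * f (suc n) + (shift oneₚ ⊛ f) n   ≡⟨ cong₂ _+_ (*-identityˡ (f (suc n))) (sym (*-distribˡ-sumTo 0ℤ n f↓)) ⟩
  f (suc n) + 0ℤ * sumTo n f↓           ≡⟨ cong (f (suc n) +_) (*-zeroˡ (sumTo n f↓)) ⟩
  f (suc n) + 0ℤ                        ≡⟨ +-identityʳ (f (suc n)) ⟩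
  f (suc n)                             ∎
  where
  open ≡-Reasoning
  f↓ : ℕ → ℤ
  f↓ i = f (n ∸ i)

module Inverse (g : PowerSeries) where

  -- approx k is already correct in degrees ≤ k: next recomputes every coefficient from the lower ones.
  next : PowerSeries → PowerSeries
  next h zero    = 1ℤ
  next h (suc m) = - (shift g ⊛ h) m

  approx : ℕ → PowerSeries
  approx zero    = oneₚ
  approx (suc k) = next (approx k)

  inverse : PowerSeries
  inverse m = approx m m

  approx-suc : ∀ k m → m ≤ k → approx (suc k) m ≡ approx k m
  approx-suc zero    zero    _           = refl
  approx-suc (suc k) zero    _           = refl
  approx-suc (suc k) (suc m) (ℕ.s≤s m≤k) =
    cong -_ (⊛-congʳ-≤ (shift g) m (λ i i≤m → approx-suc k i (ℕₚ.≤-trans i≤m m≤k)))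

  approx-stable : ∀ {m k} → m ≤′ k → approx k m ≡ inverse m
  approx-stable ≤′-refl        = refl
  approx-stable (≤′-step m≤′k) =
    trans (approx-suc _ _ (ℕₚ.≤′⇒≤ m≤′k)) (approx-stable m≤′k)

  inverse-suc : ∀ m → inverse (suc m) ≡ - (shift g ⊛ inverse) m
  inverse-suc m = cong -_ (⊛-congʳ-≤ (shift g) m (λ i i≤m → approx-stable (ℕₚ.≤⇒≤′ i≤m)))

  ⊛-inverse : InR g → (g ⊛ inverse) ≈ₚ oneₚ
  ⊛-inverse g∈R zero    rewrite g∈R = refl
  ⊛-inverse g∈R (suc n) = begin
    (g ⊛ inverse) (suc n)                                ≡⟨ ⊛-suc g inverse n ⟩
    g 0 * inverse (suc n) + (shift g ⊛ inverse) n        ≡⟨ cong₂ (λ a b → a * b + (shift g ⊛ inverse) n)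
                                                                  g∈R (inverse-suc n) ⟩
    1ℤ * - (shift g ⊛ inverse) n + (shift g ⊛ inverse) n ≡⟨ cancel ((shift g ⊛ inverse) n) ⟩
    0ℤ                                                   ∎
    where
    open ≡-Reasoning
    cancel : ∀ x → 1ℤ * - x + x ≡ 0ℤ
    cancel = solve-∀

approx-cong : ∀ {g g′} → g ≈ₚ g′ → ∀ k → Inverse.approx g k ≈ₚ Inverse.approx g′ k
approx-cong g≈g′ zero    _       = refl
approx-cong g≈g′ (suc k) zero    = refl
approx-cong g≈g′ (suc k) (suc m) = cong -_ (⊛-cong (λ i → g≈g′ (suc i)) (approx-cong g≈g′ k) m)

R : Set
R = Σ PowerSeries InR

R-abelianGroup : AbelianGroup 0ℓ 0ℓ
R-abelianGroup = record
  { Carrier        = R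
  ; _≈_            = _≈ₚ_ on proj₁
  ; _∙_            = _·_
  ; ε              = oneₚ , refl
  ; _⁻¹            = _⁻¹
  ; isAbelianGroup = record
    { isGroup = record
      { isMonoid = record
        { isSemigroup = record
          { isMagma = record
            { isEquivalence = On.isEquivalence proj₁ (Setoid.isEquivalence (ℕ →-setoid ℤ))
            ; ∙-cong        = ⊛-cong
            }
          ; assoc = λ (f , _) (g , _) (h , _) → ⊛-assoc f g h
          }
        ; identity = (λ (f , _) → ⊛-identityˡ f)
                   , (λ (f , _) n → trans (⊛-comm f oneₚ n) (⊛-identityˡ f n))
        }
      ; inverse = (λ (f , f∈R) n → trans (⊛-comm (Inverse.inverse f) f n) (Inverse.⊛-inverse f f∈R n))
                , (λ (f , f∈R) → Inverse.⊛-inverse f f∈R)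
      ; ⁻¹-cong = λ f≈g m → approx-cong f≈g m m
      }
    ; comm = λ (f , _) (g , _) → ⊛-comm f g
    }
  }
  where
  _·_ : Op₂ R
  (f , f∈R) · (g , g∈R) = f ⊛ g , cong₂ _*_ f∈R g∈R

  _⁻¹ : Op₁ R
  (f , _) ⁻¹ = Inverse.inverse f , refl

open AbelianGroupPowers R-abelianGroup using (_^_; IsPower; IsPower-lcm)

^-proj₁ : ∀ (u : R) n → proj₁ (u ^ n) ≡ proj₁ u ^ₚ n
^-proj₁ u zero    = refl
^-proj₁ u (suc n) = cong (proj₁ u ⊛_) (^-proj₁ u n)

Pow⇒InR : ∀ n {f} → Pow n f → InR f
Pow⇒InR n (g , g∈R , gⁿ≈f) =
  trans (sym (gⁿ≈f 0)) (subst InR (^-proj₁ (g , g∈R) n) (proj₂ ((g , g∈R) ^ n)))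

Pow⇔IsPower : ∀ n {f} (f∈R : InR f) → Pow n f ⇔ IsPower n (f , f∈R)
Pow⇔IsPower n {f} _ = mk⇔
  (λ (g , g∈R , gⁿ≈f) → (g , g∈R) , subst (_≈ₚ f) (sym (^-proj₁ (g , g∈R) n)) gⁿ≈f)
  (λ ((g , g∈R) , gⁿ≈f) → g , g∈R , subst (_≈ₚ f) (^-proj₁ (g , g∈R) n) gⁿ≈f)

Pow-lcm : ∀ r s {f} → InR f → (Pow r f × Pow s f) ⇔ Pow (lcm r s) f
Pow-lcm r s {f} f∈R = begin
  (Pow r f × Pow s f)                         ≈⟨ Pow⇔IsPower r f∈R ×-⇔ Pow⇔IsPower s f∈R ⟩
  (IsPower r (f , f∈R) × IsPower s (f , f∈R)) ≈⟨ IsPower-lcm r s {f , f∈R} ⟩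
  IsPower (lcm r s) (f , f∈R)                 ≈⟨ Pow⇔IsPower (lcm r s) f∈R ⟨
  Pow (lcm r s) f                             ∎
  where open SetoidReasoning (⇔-setoid 0ℓ)

lemma5 : (r s : ℕ) → r ≥ 1 → s ≥ 1 →
           (f : PowerSeries) → (Pow r f × Pow s f) ⇔ Pow (lcm r s) f
lemma5 r s _ _ f = mk⇔
  (λ pq → Equivalence.to (Pow-lcm r s (Pow⇒InR r (proj₁ pq))) pq)
  (λ p → Equivalence.from (Pow-lcm r s (Pow⇒InR (lcm r s) p)) p)
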